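{- Let $\mathcal D$ be a commutative variety of ordered algebras, let $X,Y\in\mathcal D$ and let $L:X^*\to Y$ be a language. Define the relation $\le_L$ on $|X^*|$ by $u\le_L v$ iff $L(x\bullet u\bullet y)\le L(x\bullet v\bullet y)$ for all $x,y\in|X^*|$. Then $\le_L$ is a congruence of the free $\mathcal D$-monoid $X^*$ (a preorder containing the order of $X^*$, forming a subalgebra of $X^*\times X^*$, with respect to which the multiplication is monotone), and the quotient map $X^*\to X^*/{\le_L}$ is the syntactic $\mathcal D$-monoid of $L$, i.e. $\mathrm{Syn}(L)=X^*/{\le_L}$.
   Context: Ordered $\Sigma$-algebras are posets with monotone $\Sigma$-operations; morphisms are monotone homomorphisms. A commutative variety of ordered algebras $\mathcal D$ is a class of ordered $\Sigma$-algebras ($\Sigma$ finitary) specified by inequations, such that for all $A,B$ the poset $[A,B]$ of homomorphisms (pointwise order) is a subalgebra of $B^{|A|}$. Its tensor product represents bimorphisms (maps $|A|\times|B|\to|C|$ that are morphisms in each variable); $I$ is the free algebra on one generator. A $\mathcal D$-monoid is an object $M$ with a monoid structure $(|M|,\bullet,1)$ whose multiplication is a bimorphism; morphisms preserve $\bullet,1$. $X^*$ is the free $\mathcal D$-monoid on $X$; a language is a morphism $L:X^*\to Y$. For a congruence $\preccurlyeq$ on an ordered algebra $A$, the quotient $A/{\preccurlyeq}$ is $A$ modulo the equivalence $\preccurlyeq\cap\succcurlyeq$, ordered by $[u]\le[v]$ iff $u\preccurlyeq v$. A $\mathcal D$-monoid morphism $e:X^*\to M$ recognizes $L$ if $L=f\circ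 e$ for some morphism $f:M\to Y$. An $X$-generated $\mathcal D$-monoid is a surjective $\mathcal D$-monoid morphism $e:X^*\to M$; $e_1\le e_2$ iff $e_1=h\circ e_2$ for a $\mathcal D$-monoid morphism $h$. The syntactic $\mathcal D$-monoid is the (unique up to iso) $X$-generated $\mathcal D$-monoid recognizing $L$ that is $\le$ every $X$-generated $\mathcal D$-monoid recognizing $L$. -}

module Defs where

open import Level using (0ℓ)
open import Data.Nat using (ℕ)
open import Data.Fin using (Fin)
open import Data.Product using (Σ; _×_; _,_; proj₁; proj₂)
open import Relation.Binary.Structures using (IsPartialOrder; IsPreorder; IsEquivalence)

record Signature : Set₁ where
  field
    Op    : Set
    arity : Op → ℕ

module OrderedAlgebra (S : Signature) where
  open Signature S

  record OrdAlg : Set₁ where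
    field
      Carrier        : Set
      _≈_            : Carrier → Carrier → Set
      _≤_            : Carrier → Carrier → Set
      isPartialOrder : IsPartialOrder _≈_ _≤_
      ⟦_⟧            : (o : Op) → (Fin (arity o) → Carrier) → Carrier
      ⟦⟧-mono        : ∀ o {as bs : Fin (arity o) → Carrier} →
                       (∀ i → as i ≤ bs i) → ⟦ o ⟧ as ≤ ⟦ o ⟧ bs

  data Term (V : Set) : Set where
    var : V → Term V
    op  : (o : Op) → (Fin (arity o) → Term V) → Term V

  evalWith : {C : Set} → ((o : Op) → (Fin (arity o) → C) → C) →
             {V : Set} → (V → C) → Term V → C
  evalWith f ρ (var v)   = ρ v
  evalWith f ρ (op o ts) = f o (λ i → evalWith f ρ (ts i))

  eval : (A : OrdAlg) {V : Set} → (V → OrdAlg.Carrier A) → Term V → OrdAlg.Carrier A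
  eval A = evalWith (OrdAlg.⟦_⟧ A)

  record Inequation : Set where
    field
      nvars : ℕ
      lhs   : Term (Fin nvars)
      rhs   : Term (Fin nvars)

  Satisfies : OrdAlg → Inequation → Set
  Satisfies A e = (ρ : Fin (Inequation.nvars e) → OrdAlg.Carrier A) →
    OrdAlg._≤_ A (eval A ρ (Inequation.lhs e)) (eval A ρ (Inequation.rhs e))

record Variety : Set₁ where
  field
    sig   : Signature
    Idx   : Set
    axiom : Idx → OrderedAlgebra.Inequation sig

module VarietyDefs {D : Variety} where
  open Variety D
  open Signature sig
  open OrderedAlgebra sig public

  record DAlg : Set₁ where
    field
      alg : OrdAlg
      sat : ∀ i → Satisfies alg (axiom i)

  Car : DAlg → Set
  Car A = OrdAlg.Carrier (DAlg.alg A)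

  Eq : (A : DAlg) → Car A → Car A → Set
  Eq A = OrdAlg._≈_ (DAlg.alg A)

  Le : (A : DAlg) → Car A → Car A → Set
  Le A = OrdAlg._≤_ (DAlg.alg A)

  opr : (A : DAlg) → (o : Op) → (Fin (arity o) → Car A) → Car A
  opr A = OrdAlg.⟦_⟧ (DAlg.alg A)

  record IsHom (A B : DAlg) (f : Car A → Car B) : Set where
    field
      mono : ∀ {a a'} → Le A a a' → Le B (f a) (f a')
      pres : ∀ o (as : Fin (arity o) → Car A) →
             Eq B (f (opr A o as)) (opr B o (λ i → f (as i)))

  record Hom (A B : DAlg) : Set where
    field
      fun   : Car A → Car B
      isHom : IsHom A B fun

  -- commutativity: [A,B] is closed under the pointwise operations of B^|A|
  IsCommutative : Set₁
  IsCommutative = (A B : DAlg) (o : Op) (hs : Fin (arity o) → Hom A B) →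
    IsHom A B (λ a → opr B o (λ i → Hom.fun (hs i) a))

  record DMon : Set₁ where
    field
      obj       : DAlg
      _∙_       : Car obj → Car obj → Car obj
      ε         : Car obj
      assoc     : ∀ x y z → Eq obj ((x ∙ y) ∙ z) (x ∙ (y ∙ z))
      identityˡ : ∀ x → Eq obj (ε ∙ x) x
      identityʳ : ∀ x → Eq obj (x ∙ ε) x
      ∙-homˡ    : ∀ b → IsHom obj obj (λ a → a ∙ b)
      ∙-homʳ    : ∀ a → IsHom obj obj (λ b → a ∙ b)

  MCar : DMon → Set
  MCar M = Car (DMon.obj M)

  record DMonHom (M N : DMon) : Set where
    field
      fun   : MCar M → MCar N
      isHom : IsHom (DMon.obj M) (DMon.obj N) fun
      pres-∙ : ∀ x y → Eq (DMon.obj N) (fun (DMon._∙_ M x y)) (DMon._∙_ N (fun x) (fun y))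
      pres-ε : Eq (DMon.obj N) (fun (DMon.ε M)) (DMon.ε N)

  record IsFreeDMon (X : DAlg) (M : DMon) (η : Hom X (DMon.obj M)) : Set₁ where
    field
      extend   : (N : DMon) → Hom X (DMon.obj N) → DMonHom M N
      extend-η : ∀ N g x → Eq (DMon.obj N) (DMonHom.fun (extend N g) (Hom.fun η x)) (Hom.fun g x)
      unique   : ∀ N g (h : DMonHom M N) →
                 (∀ x → Eq (DMon.obj N) (DMonHom.fun h (Hom.fun η x)) (Hom.fun g x)) →
                 ∀ u → Eq (DMon.obj N) (DMonHom.fun h u) (DMonHom.fun (extend N g) u)

  SynOrd : (X* : DMon) (Y : DAlg) (L : Hom (DMon.obj X*) Y) → MCar X* → MCar X* → Set
  SynOrd X* Y L u v = ∀ x y →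
    Le Y (Hom.fun L ((x ∙ u) ∙ y)) (Hom.fun L ((x ∙ v) ∙ y))
    where open DMon X*

  record IsCongruence (M : DMon) (R : MCar M → MCar M → Set) : Set where
    open DMon M
    field
      R-refl  : ∀ a → R a a
      R-trans : ∀ {a b c} → R a b → R b c → R a c
      ≤⊆R     : ∀ {a b} → Le obj a b → R a b
      op-cl   : ∀ o {as bs : Fin (arity o) → MCar M} →
                (∀ i → R (as i) (bs i)) → R (opr obj o as) (opr obj o bs)
      ∙-mono  : ∀ {a a' b b'} → R a a' → R b b' → R (a ∙ b) (a' ∙ b')

  module Quotient (M : DMon) (R : MCar M → MCar M → Set) (c : IsCongruence M R) where
    open DMon M
    open IsCongruence c
    module A = OrdAlg (DAlg.alg obj)

    ≈⇒R : ∀ {a b} → Eq obj a b → R a b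
    ≈⇒R e = ≤⊆R (IsPartialOrder.reflexive A.isPartialOrder e)

    ≈⇒R² : ∀ {a b} → Eq obj a b → R a b × R b a
    ≈⇒R² e = ≈⇒R e , ≈⇒R (IsEquivalence.sym (IsPartialOrder.isEquivalence A.isPartialOrder) e)

    qAlg : OrdAlg
    qAlg = record
      { Carrier = MCar M
      ; _≈_ = λ a b → R a b × R b a
      ; _≤_ = R
      ; isPartialOrder = record
          { isPreorder = record
              { isEquivalence = record
                  { refl = R-refl _ , R-refl _
                  ; sym = λ p → proj₂ p , proj₁ p
                  ; trans = λ p q → R-trans (proj₁ p) (proj₁ q) , R-trans (proj₂ q) (proj₂ p) }
              ; reflexive = proj₁
              ; trans = R-trans }
          ; antisym = _,_ }
      ; ⟦_⟧ = A.⟦_⟧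
      ; ⟦⟧-mono = op-cl }

    qObj : DAlg
    qObj = record { alg = qAlg ; sat = λ i ρ → ≤⊆R (DAlg.sat obj i ρ) }

    qMon : DMon
    qMon = record
      { obj = qObj
      ; _∙_ = _∙_
      ; ε = ε
      ; assoc = λ x y z → ≈⇒R² (assoc x y z)
      ; identityˡ = λ x → ≈⇒R² (identityˡ x)
      ; identityʳ = λ x → ≈⇒R² (identityʳ x)
      ; ∙-homˡ = λ b → record
          { mono = λ p → ∙-mono p (R-refl b)
          ; pres = λ o as → ≈⇒R² (IsHom.pres (∙-homˡ b) o as) }
      ; ∙-homʳ = λ a → record
          { mono = λ p → ∙-mono (R-refl a) p
          ; pres = λ o as → ≈⇒R² (IsHom.pres (∙-homʳ a) o as) } }

    qMap : DMonHom M qMon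
    qMap = record
      { fun = λ u → u
      ; isHom = record { mono = ≤⊆R ; pres = λ o as → R-refl _ , R-refl _ }
      ; pres-∙ = λ x y → R-refl _ , R-refl _
      ; pres-ε = R-refl _ , R-refl _ }

  record XGen (X* : DMon) : Set₁ where
    field
      M    : DMon
      e    : DMonHom X* M
      surj : ∀ m → Σ (MCar X*) λ u → Eq (DMon.obj M) (DMonHom.fun e u) m

  Recognizes : {X* : DMon} {Y : DAlg} → Hom (DMon.obj X*) Y → XGen X* → Set
  Recognizes {X*} {Y} L g = Σ (Hom (DMon.obj M) Y) λ f →
      ∀ u → Eq Y (Hom.fun L u) (Hom.fun f (DMonHom.fun e u))
    where open XGen g

  _≤Gen_ : {X* : DMon} → XGen X* → XGen X* → Set
  g₁ ≤Gen g₂ = Σ (DMonHom (XGen.M g₂) (XGen.M g₁)) λ h →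
      ∀ u → Eq (DMon.obj (XGen.M g₁)) (DMonHom.fun (XGen.e g₁) u)
               (DMonHom.fun h (DMonHom.fun (XGen.e g₂) u))

  IsSyntactic : {X* : DMon} {Y : DAlg} → Hom (DMon.obj X*) Y → XGen X* → Set₁
  IsSyntactic {X*} L g =
    Recognizes L g × ((g' : XGen X*) → Recognizes L g' → g ≤Gen g')

  quotientGen : (M : DMon) (R : MCar M → MCar M → Set) → IsCongruence M R → XGen M
  quotientGen M R c = record
    { M = Quotient.qMon M R c
    ; e = Quotient.qMap M R c
    ; surj = λ m → m , (IsCongruence.R-refl c m , IsCongruence.R-refl c m) }

open VarietyDefs public

module Submission where

-- For a D-monoid M and a morphism L : M → Y, the relation
--   u ≤_L v  ⇔  ∀ x y. L((x∙u)∙y) ≤ L((x∙v)∙y)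
-- is compared through the "context maps" u ↦ (x∙u)∙y, which are
-- homomorphisms of ordered algebras because ∙ is a bimorphism.
--  * ≤_L is a congruence: reflexivity/transitivity are pointwise, the
--    order of M and the operations are preserved because L ∘ context is a
--    homomorphism, and ∙ is monotone by reassociating the contexts.
--  * L is monotone for ≤_L (take the empty context), so L factors
--    through M/≤_L: the quotient map recognises L.
--  * If e : M ↠ N recognises L via f, then e u ≤ e v implies u ≤_L v; and
--    for any congruence R with this property, a section of e is a
--    D-monoid morphism N → M/R through which the quotient map factors.
-- The theorem instantiates these facts with M = X*.

open import Defs
open import Level using (0ℓ)
open import Data.Product using (Σ; _,_; proj₁; proj₂)
open import Data.Fin using (Fin)
open import Relation.Binary.Bundles using (Poset)
import Relation.Binary.Reasoning.PartialOrder as PosetReasoning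

module AlgebraOrder {D : Variety} (A : DAlg {D}) where
  open Signature (Variety.sig D)
  open OrderedAlgebra (Variety.sig D) using (module OrdAlg)

  poset : Poset 0ℓ 0ℓ 0ℓ
  poset = record { isPartialOrder = OrdAlg.isPartialOrder (DAlg.alg A) }

  open Poset poset public using (reflexive; antisym) renaming (refl to ≤-refl; trans to ≤-trans)
  open Poset poset public using () renaming (module Eq to ≈)
  open PosetReasoning poset public

  opr-mono : ∀ o {as bs : Fin (arity o) → Car A} →
             (∀ i → Le A (as i) (bs i)) → Le A (opr A o as) (opr A o bs)
  opr-mono = OrdAlg.⟦⟧-mono (DAlg.alg A)

  opr-cong : ∀ o {as bs : Fin (arity o) → Car A} →
             (∀ i → Eq A (as i) (bs i)) → Eq A (opr A o as) (opr A o bs)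
  opr-cong o e = antisym (opr-mono o (λ i → reflexive (e i)))
                         (opr-mono o (λ i → reflexive (≈.sym (e i))))

module _ {D : Variety} where
  open Signature (Variety.sig D)

  -- A monotone map respects ≈, since ≈ is the symmetric part of ≤.
  hom-cong : {A B : DAlg {D}} {h : Car A → Car B} → IsHom A B h →
             ∀ {a a'} → Eq A a a' → Eq B (h a) (h a')
  hom-cong {A} {B} hom e =
    B.antisym (IsHom.mono hom (A.reflexive e)) (IsHom.mono hom (A.reflexive (A.≈.sym e)))
    where module A = AlgebraOrder A
          module B = AlgebraOrder B

  hom-∘ : {A B C : DAlg {D}} {f : Car A → Car B} {g : Car B → Car C} →
          IsHom A B f → IsHom B C g → IsHom A C (λ a → g (f a))
  hom-∘ {C = C} {f = f} F G = record
    { mono = λ p → IsHom.mono G (IsHom.mono F p)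
    ; pres = λ o as → AlgebraOrder.≈.trans C (hom-cong G (IsHom.pres F o as))
                                             (IsHom.pres G o (λ i → f (as i))) }

  hom-opr-mono : {A B : DAlg {D}} {h : Car A → Car B} → IsHom A B h →
                 ∀ o {as bs : Fin (arity o) → Car A} →
                 (∀ i → Le B (h (as i)) (h (bs i))) → Le B (h (opr A o as)) (h (opr A o bs))
  hom-opr-mono {A} {B} {h} hom o {as} {bs} p = begin
    h (opr A o as)             ≈⟨ IsHom.pres hom o as ⟩
    opr B o (λ i → h (as i))   ≤⟨ opr-mono o p ⟩
    opr B o (λ i → h (bs i))   ≈⟨ IsHom.pres hom o bs ⟨
    h (opr A o bs)             ∎
    where open AlgebraOrder B

module MonoidOrder {D : Variety} (M : DMon {D}) where
  open DMon M
  open AlgebraOrder obj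

  ∙-cong : ∀ {a a' b b'} → Eq obj a a' → Eq obj b b' → Eq obj (a ∙ b) (a' ∙ b')
  ∙-cong {a' = a'} {b = b} p q = ≈.trans (hom-cong (∙-homˡ b) p) (hom-cong (∙-homʳ a') q)

  context : MCar M → MCar M → MCar M → MCar M
  context x y u = (x ∙ u) ∙ y

  context-isHom : ∀ x y → IsHom obj obj (context x y)
  context-isHom x y = hom-∘ (∙-homʳ x) (∙-homˡ y)

  context-ε : ∀ u → Eq obj (context ε ε u) u
  context-ε u = ≈.trans (identityʳ (ε ∙ u)) (identityˡ u)

  context-∙ʳ : ∀ x y u v → Eq obj (context x y (u ∙ v)) (context (x ∙ u) y v)
  context-∙ʳ x y u v = ∙-cong (≈.sym (assoc x u v)) ≈.refl

  context-∙ˡ : ∀ x y u v → Eq obj (context x y (u ∙ v)) (context x (v ∙ y) u)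
  context-∙ˡ x y u v = ≈.trans (context-∙ʳ x y u v) (assoc (x ∙ u) v y)

hom-context : {D : Variety} {M N : DMon {D}} (e : DMonHom M N) → ∀ x y u →
  Eq (DMon.obj N) (DMonHom.fun e (MonoidOrder.context M x y u))
                  (MonoidOrder.context N (DMonHom.fun e x) (DMonHom.fun e y) (DMonHom.fun e u))
hom-context {M = M} {N = N} e x y u =
  ≈.trans (pres-∙ (x ∙ u) y) (MonoidOrder.∙-cong N (pres-∙ x u) ≈.refl)
  where open DMonHom e
        open DMon M using (_∙_)
        open AlgebraOrder (DMon.obj N) using (module ≈)

module SyntacticOrder {D : Variety} (M : DMon {D}) (Y : DAlg {D})
                      (L : Hom (DMon.obj M) Y) where
  open DMon M
  open MonoidOrder M using (context; context-isHom; context-ε; context-∙ˡ; context-∙ʳ)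
  open AlgebraOrder Y
  open Hom L renaming (fun to ⟦L⟧)

  _≤L_ : MCar M → MCar M → Set
  _≤L_ = SynOrd M Y L

  ⟦L⟧-cong : ∀ {u v} → Eq obj u v → Eq Y (⟦L⟧ u) (⟦L⟧ v)
  ⟦L⟧-cong = hom-cong isHom

  ≤⇒≤L : ∀ {u v} → Le obj u v → u ≤L v
  ≤⇒≤L p x y = IsHom.mono isHom (IsHom.mono (context-isHom x y) p)

  ≤L-opr : ∀ o {us vs : Fin (Signature.arity (Variety.sig D) o) → MCar M} →
           (∀ i → us i ≤L vs i) → opr obj o us ≤L opr obj o vs
  ≤L-opr o p x y = hom-opr-mono (hom-∘ (context-isHom x y) isHom) o (λ i → p i x y)

  -- Multiplying on the right: the factor v is absorbed into the right context.
  ≤L-∙ˡ : ∀ {u u'} v → u ≤L u' → (u ∙ v) ≤L (u' ∙ v)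
  ≤L-∙ˡ {u} {u'} v p x y = begin
    ⟦L⟧ (context x y (u ∙ v))    ≈⟨ ⟦L⟧-cong (context-∙ˡ x y u v) ⟩
    ⟦L⟧ (context x (v ∙ y) u)    ≤⟨ p x (v ∙ y) ⟩
    ⟦L⟧ (context x (v ∙ y) u')   ≈⟨ ⟦L⟧-cong (context-∙ˡ x y u' v) ⟨
    ⟦L⟧ (context x y (u' ∙ v))   ∎

  -- Multiplying on the left: the factor u is absorbed into the left context.
  ≤L-∙ʳ : ∀ u {v v'} → v ≤L v' → (u ∙ v) ≤L (u ∙ v')
  ≤L-∙ʳ u {v} {v'} q x y = begin
    ⟦L⟧ (context x y (u ∙ v))    ≈⟨ ⟦L⟧-cong (context-∙ʳ x y u v) ⟩
    ⟦L⟧ (context (x ∙ u) y v)    ≤⟨ q (x ∙ u) y ⟩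
    ⟦L⟧ (context (x ∙ u) y v')   ≈⟨ ⟦L⟧-cong (context-∙ʳ x y u v') ⟨
    ⟦L⟧ (context x y (u ∙ v'))   ∎

  isCongruence : IsCongruence M _≤L_
  isCongruence = record
    { R-refl  = λ u x y → ≤-refl
    ; R-trans = λ p q x y → ≤-trans (p x y) (q x y)
    ; ≤⊆R     = ≤⇒≤L
    ; op-cl   = ≤L-opr
    ; ∙-mono  = λ {a' = u'} {b = v} p q x y → ≤-trans (≤L-∙ˡ v p x y) (≤L-∙ʳ u' q x y) }

  -- L is monotone for ≤_L: evaluate the definition in the empty context.
  ≤L⇒L≤ : ∀ {u v} → u ≤L v → Le Y (⟦L⟧ u) (⟦L⟧ v)
  ≤L⇒L≤ {u} {v} p = begin
    ⟦L⟧ u                  ≈⟨ ⟦L⟧-cong (context-ε u) ⟨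
    ⟦L⟧ (context ε ε u)    ≤⟨ p ε ε ⟩
    ⟦L⟧ (context ε ε v)    ≈⟨ ⟦L⟧-cong (context-ε v) ⟩
    ⟦L⟧ v                  ∎

  quotient-recognizes : Recognizes L (quotientGen M _≤L_ isCongruence)
  quotient-recognizes =
    record { fun = ⟦L⟧ ; isHom = record { mono = ≤L⇒L≤ ; pres = IsHom.pres isHom } } ,
    λ u → ≈.refl

  recognizer-reflects : {N : DMon {D}} (e : DMonHom M N) (f : Hom (DMon.obj N) Y) →
    (∀ u → Eq Y (⟦L⟧ u) (Hom.fun f (DMonHom.fun e u))) →
    ∀ {u v} → Le (DMon.obj N) (DMonHom.fun e u) (DMonHom.fun e v) → u ≤L v
  recognizer-reflects {N} e f recognizes {u} {v} p x y = begin
    ⟦L⟧ (context x y u)                     ≈⟨ recognizes (context x y u) ⟩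
    ⟦f⟧ (e⟨ context x y u ⟩)                 ≈⟨ hom-cong (Hom.isHom f) (hom-context e x y u) ⟩
    ⟦f⟧ (contextN e⟨ x ⟩ e⟨ y ⟩ e⟨ u ⟩)        ≤⟨ IsHom.mono (Hom.isHom f)
                                                 (IsHom.mono (contextN-isHom e⟨ x ⟩ e⟨ y ⟩) p) ⟩
    ⟦f⟧ (contextN e⟨ x ⟩ e⟨ y ⟩ e⟨ v ⟩)        ≈⟨ hom-cong (Hom.isHom f) (hom-context e x y v) ⟨
    ⟦f⟧ (e⟨ context x y v ⟩)                 ≈⟨ recognizes (context x y v) ⟨
    ⟦L⟧ (context x y v)                     ∎
    where
      e⟨_⟩ : MCar M → MCar N
      e⟨_⟩ = DMonHom.fun e
      ⟦f⟧ : MCar N → Car Y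
      ⟦f⟧ = Hom.fun f
      open MonoidOrder N using () renaming (context to contextN; context-isHom to contextN-isHom)

module SectionIntoQuotient {D : Variety} (M : DMon {D}) (R : MCar M → MCar M → Set)
    (c : IsCongruence M R) (g : XGen M)
    (reflect : ∀ {u v} → Le (DMon.obj (XGen.M g)) (DMonHom.fun (XGen.e g) u)
                                                   (DMonHom.fun (XGen.e g) v) → R u v) where
  open XGen g renaming (M to N)
  open DMon N using (obj; _∙_; ε)
  open AlgebraOrder obj
  open Quotient M R c using (qMon)

  e⟨_⟩ : MCar M → MCar N
  e⟨_⟩ = DMonHom.fun e

  section : MCar N → MCar M
  section n = proj₁ (surj n)

  section-inverse : ∀ n → Eq obj e⟨ section n ⟩ n
  section-inverse n = proj₂ (surj n)

  reflect≈ : ∀ {u v} → Eq obj e⟨ u ⟩ e⟨ v ⟩ → Eq (DMon.obj qMon) u v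
  reflect≈ p = reflect (reflexive p) , reflect (reflexive (≈.sym p))

  -- Each preservation law holds in N after applying e, hence in M/R by reflect.
  sectionHom : DMonHom N qMon
  sectionHom = record
    { fun    = section
    ; isHom  = record
        { mono = λ {a} {a'} p → reflect (begin
            e⟨ section a ⟩    ≈⟨ section-inverse a ⟩
            a                 ≤⟨ p ⟩
            a'                ≈⟨ section-inverse a' ⟨
            e⟨ section a' ⟩   ∎)
        ; pres = λ o ns → reflect≈ (begin-equality
            e⟨ section (opr obj o ns) ⟩                 ≈⟨ section-inverse _ ⟩
            opr obj o ns                                ≈⟨ opr-cong o (λ i → section-inverse (ns i)) ⟨
            opr obj o (λ i → e⟨ section (ns i) ⟩)        ≈⟨ IsHom.pres (DMonHom.isHom e) o _ ⟨
            e⟨ opr (DMon.obj M) o (λ i → section (ns i)) ⟩ ∎) }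
    ; pres-∙ = λ a b → reflect≈ (begin-equality
        e⟨ section (a ∙ b) ⟩                      ≈⟨ section-inverse (a ∙ b) ⟩
        a ∙ b                                     ≈⟨ MonoidOrder.∙-cong N (section-inverse a)
                                                                           (section-inverse b) ⟨
        e⟨ section a ⟩ ∙ e⟨ section b ⟩            ≈⟨ DMonHom.pres-∙ e _ _ ⟨
        e⟨ DMon._∙_ M (section a) (section b) ⟩    ∎)
    ; pres-ε = reflect≈ (≈.trans (section-inverse ε) (≈.sym (DMonHom.pres-ε e))) }

  -- The quotient map is sectionHom ∘ e, since e (section (e u)) ≈ e u.
  quotient-below : quotientGen M R c ≤Gen g
  quotient-below = sectionHom , λ u → reflect≈ (≈.sym (section-inverse e⟨ u ⟩))

theorem3p17 : (D : Variety) → IsCommutative {D} →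
    (X Y : DAlg {D}) (X* : DMon {D}) (η : Hom X (DMon.obj X*)) → IsFreeDMon X X* η →
    (L : Hom (DMon.obj X*) Y) →
    Σ (IsCongruence X* (SynOrd X* Y L)) λ c →
    IsSyntactic L (quotientGen X* (SynOrd X* Y L) c)
theorem3p17 _ _ _ Y X* _ _ L = isCongruence , quotient-recognizes , minimal
  where
    open SyntacticOrder X* Y L

    minimal : (g : XGen X*) → Recognizes L g → quotientGen X* _≤L_ isCongruence ≤Gen g
    minimal g (f , recognizes) =
      SectionIntoQuotient.quotient-below X* _≤L_ isCongruence g
        (recognizer-reflects (XGen.e g) f recognizes)
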